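{- Let $G=(V,E)$ be a graph with $n \ge 1$ nodes and $m$ edges, let $k$ be a positive integer, and let $\preceq$ be any total ordering of $V$. Then the number of $\preceq$-capped $k$-walks in $G$ is at least $n\cdot\left(\frac{m}{2n}\right)^k$.
   Context: Graphs are undirected and simple. For a total ordering $\preceq$ of $V$ and a positive integer $k$, a $(k+1)$-tuple $(x_0,\ldots,x_k)\in V^{k+1}$ is a $\preceq$-capped $k$-walk if it is a walk in $G$ (i.e. $\{x_{i-1},x_i\}\in E$ for all $i=1,\dots,k$; nodes may repeat) and $x_0 \succeq x_i$ for every $i=1,\ldots,k$. -}

module Defs where

open import Level using (0ℓ)
open import Data.Nat using (ℕ; zero; suc)
open import Data.Fin using (Fin; _<_; _<?_)
open import Data.Fin.Properties using (_≟_)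
open import Data.List using (List; []; _∷_; [_]; map; concatMap; allFin; filter; length; cartesianProduct)
open import Data.Vec using (Vec; []; _∷_)
open import Data.Vec.Relation.Unary.All using (All; all?)
open import Data.Product using (_×_; _,_; proj₁; proj₂)
open import Data.Unit using (⊤; tt)
open import Relation.Nullary using (Dec; yes; no; ¬_)
open import Relation.Nullary.Decidable using (_×-dec_)
open import Relation.Binary using (Rel; Decidable; Symmetric; Irreflexive; IsDecTotalOrder)
open import Relation.Binary.PropositionalEquality using (_≡_)

record Graph (n : ℕ) : Set₁ where
  field
    Adj   : Rel (Fin n) 0ℓ
    adj?  : Decidable Adj
    sym   : Symmetric Adj
    irrefl : Irreflexive _≡_ Adj
open Graph public

-- Number of edges: unordered pairs {i, j} with Adj i j, counted as i < j.
numEdges : ∀ {n} → Graph n → ℕ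
numEdges {n} G =
  length (filter (λ p → (proj₁ p <? proj₂ p) ×-dec adj? G (proj₁ p) (proj₂ p))
                 (cartesianProduct (allFin n) (allFin n)))

allTuples : (n k : ℕ) → List (Vec (Fin n) k)
allTuples n zero = [ [] ]
allTuples n (suc k) = concatMap (λ x → map (x ∷_) (allTuples n k)) (allFin n)

IsWalk : ∀ {n k} → Graph n → Vec (Fin n) (suc k) → Set
IsWalk G (x ∷ []) = ⊤
IsWalk G (x ∷ y ∷ xs) = Adj G x y × IsWalk G (y ∷ xs)

isWalk? : ∀ {n k} (G : Graph n) (v : Vec (Fin n) (suc k)) → Dec (IsWalk G v)
isWalk? G (x ∷ []) = yes tt
isWalk? G (x ∷ y ∷ xs) = adj? G x y ×-dec isWalk? G (y ∷ xs)

IsCapped : ∀ {n k} (_≼_ : Rel (Fin n) 0ℓ) → Vec (Fin n) (suc k) → Set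
IsCapped _≼_ (x ∷ xs) = All (λ y → y ≼ x) xs

isCapped? : ∀ {n k} {_≼_ : Rel (Fin n) 0ℓ} → Decidable _≼_ →
            (v : Vec (Fin n) (suc k)) → Dec (IsCapped _≼_ v)
isCapped? d (x ∷ xs) = all? (λ y → d y x) xs

IsCappedWalk : ∀ {n k} → Graph n → Rel (Fin n) 0ℓ → Vec (Fin n) (suc k) → Set
IsCappedWalk G _≼_ v = IsWalk G v × IsCapped _≼_ v

-- Number of ≼-capped k-walks, i.e. (k+1)-tuples in V^(k+1).
numCappedWalks : ∀ {n} (G : Graph n) {_≼_ : Rel (Fin n) 0ℓ} →
                 IsDecTotalOrder _≡_ _≼_ → (k : ℕ) → ℕ
numCappedWalks {n} G {_≼_} ord k =
  length (filter (λ v → isWalk? G v ×-dec isCapped? (IsDecTotalOrder._≤?_ ord) v)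
                 (allTuples n (suc k)))

module Submission where

-- Fix p, q and k.  The degeneracy bound for a vertex set S is
--     p^k · q · e(S)  ≤  W(S) · q^(k+1) + |S| · p^(k+1),
-- where e(S) counts the edges inside S and W(S) the capped (k+1)-walks
-- inside S.  Every S satisfies this, by induction on |S|:
--   * if some v ∈ S has q · deg_S(v) < p, delete v: we lose fewer than p/q
--     edges, paid for by the term p^(k+1) of the removed vertex;
--   * otherwise S has minimum degree ≥ p/q, so from the ≼-greatest vertex t
--     of S there are at least deg_S(t) · (p/q)^k walks of length k+1 inside S,
--     all capped by t; deleting t loses deg_S(t) edges, paid for by these walks.
-- With p = m, q = 2n and S = V this reads 2n·m^(k+1) ≤ W·(2n)^(k+1) + n·m^(k+1),
-- which is the theorem.

open import Defs hiding (sym)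
open import Level using (0ℓ)
open import Data.Bool using (Bool; true; false; _∧_; not)
import Data.Bool.Properties as Bool
open import Data.Empty using (⊥; ⊥-elim)
open import Data.Fin using (Fin; zero; suc)
import Data.Fin as Fin
import Data.Fin.Properties as Fin
open import Data.List using (List; []; _∷_; _++_; map; concatMap; allFin; filter; length; tabulate; cartesianProduct)
open import Data.List.Membership.Propositional using (_∈_)
open import Data.List.Membership.Propositional.Properties using (∈-allFin)
open import Data.List.Relation.Unary.Any using (here; there)
open import Data.Nat using (ℕ; zero; suc; _+_; _*_; _^_; _≤_; _<_; _<?_; z≤n; s≤s⁻¹)
open import Data.Nat.Properties hiding (_≟_)
open import Data.Nat.Tactic.RingSolver using (solve-∀)
open import Data.Product using (_×_; _,_; ∃)
open import Data.Sum using (_⊎_; inj₁; inj₂)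
open import Data.Vec using (Vec; _∷_)
open import Data.Vec.Relation.Unary.All using (all?)
open import Function using (_∘_; id)
open import Function.Bundles using (mk⇔)
open import Relation.Binary using (Rel; IsDecTotalOrder)
open import Relation.Binary.PropositionalEquality
open import Relation.Nullary using (Dec; yes; no; does; _×-dec_)
open import Relation.Nullary.Decidable using (dec-true; does-⇔)
open import Algebra.Properties.Semiring.Sum +-*-semiring
  using (sum; sum-syntax; sum-cong-≗; sum-replicate-zero; *-distribˡ-sum; *-distribʳ-sum)
open import Algebra.Properties.CommutativeSemigroup *-commutativeSemigroup using (x∙yz≈y∙xz; xy∙z≈y∙zx)
open import Algebra.Properties.CommutativeMonoid.Sum +-0-commutativeMonoid using (∑-distrib-+)

𝟙 : Bool → ℕ
𝟙 true  = 1
𝟙 false = 0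

𝟙-∧ : ∀ a b → 𝟙 (a ∧ b) ≡ 𝟙 a * 𝟙 b
𝟙-∧ true  b = sym (+-identityʳ (𝟙 b))
𝟙-∧ false b = refl

𝟙-mono : ∀ {a b} → (a ≡ true → b ≡ true) → 𝟙 a ≤ 𝟙 b
𝟙-mono {false} _   = z≤n
𝟙-mono {true}  a⇒b rewrite a⇒b refl = ≤-refl

𝟙-guard : ∀ b {x y} → (b ≡ true → x ≤ y) → 𝟙 b * x ≤ 𝟙 b * y
𝟙-guard false _   = z≤n
𝟙-guard true  x≤y = +-monoˡ-≤ 0 (x≤y refl)

∧-monoˡ : ∀ {a b} c → (a ≡ true → b ≡ true) → a ∧ c ≡ true → b ∧ c ≡ true
∧-monoˡ {true} c a⇒b h rewrite a⇒b refl = h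

true≢false : ∀ {b} → b ≡ true → b ≡ false → ⊥
true≢false refl ()

𝟙-exclusive : ∀ {A B : Set} s c (a? : Dec A) (b? : Dec B) → (A → B → ⊥) →
  𝟙 (s ∧ (does a? ∧ c)) + 𝟙 (s ∧ (does b? ∧ c)) ≤ 𝟙 (s ∧ c)
𝟙-exclusive false c _       _       _    = z≤n
𝟙-exclusive true  c (yes a) (yes b) a⇏b = ⊥-elim (a⇏b a b)
𝟙-exclusive true  c (yes _) (no _)  _    = ≤-reflexive (+-identityʳ (𝟙 c))
𝟙-exclusive true  c (no _)  (yes _) _    = ≤-refl
𝟙-exclusive true  c (no _)  (no _)  _    = z≤n

∑-mono-≤ : ∀ {n} {f g : Fin n → ℕ} → (∀ i → f i ≤ g i) → ∑[ i < n ] f i ≤ ∑[ i < n ] g i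
∑-mono-≤ {zero}  _   = z≤n
∑-mono-≤ {suc n} f≤g = +-mono-≤ (f≤g zero) (∑-mono-≤ (f≤g ∘ suc))

∑-zero : ∀ {n} {f : Fin n → ℕ} → (∀ i → f i ≡ 0) → ∑[ i < n ] f i ≡ 0
∑-zero {n} f≡0 = trans (sum-cong-≗ f≡0) (sum-replicate-zero n)

∑-one : ∀ n → ∑[ i < n ] 1 ≡ n
∑-one zero    = refl
∑-one (suc n) = cong suc (∑-one n)

∑-distrib-+₃ : ∀ {n} (f g h : Fin n → ℕ) →
  ∑[ i < n ] (f i + g i + h i) ≡ ∑[ i < n ] f i + ∑[ i < n ] g i + ∑[ i < n ] h i
∑-distrib-+₃ f g h =
  trans (∑-distrib-+ (λ i → f i + g i) h) (cong (_+ sum h) (∑-distrib-+ f g))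

δ : ∀ {n} → Fin n → Fin n → ℕ
δ v u = 𝟙 (does (u Fin.≟ v))

∑-δ : ∀ {n} (v : Fin n) c → ∑[ u < n ] (δ v u * c) ≡ c
∑-δ {suc n} zero c =
  trans (cong (c + 0 +_) (sum-replicate-zero n)) (trans (+-identityʳ _) (+-identityʳ c))
∑-δ {suc n} (suc v) c = ∑-δ v c

listSum : {A : Set} → (A → ℕ) → List A → ℕ
listSum f []       = 0
listSum f (x ∷ xs) = f x + listSum f xs

listSum-cong : {A : Set} {f g : A → ℕ} → (∀ x → f x ≡ g x) → ∀ xs → listSum f xs ≡ listSum g xs
listSum-cong f≡g []       = refl
listSum-cong f≡g (x ∷ xs) = cong₂ _+_ (f≡g x) (listSum-cong f≡g xs)

length-filter : {A : Set} {P : A → Set} (P? : ∀ x → Dec (P x)) (xs : List A) →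
  length (filter P? xs) ≡ listSum (𝟙 ∘ does ∘ P?) xs
length-filter P? []       = refl
length-filter P? (x ∷ xs) with does (P? x)
... | true  = cong suc (length-filter P? xs)
... | false = length-filter P? xs

listSum-++ : {A : Set} (f : A → ℕ) (xs ys : List A) → listSum f (xs ++ ys) ≡ listSum f xs + listSum f ys
listSum-++ f []       ys = refl
listSum-++ f (x ∷ xs) ys = trans (cong (f x +_) (listSum-++ f xs ys)) (sym (+-assoc (f x) _ _))

listSum-map : {A B : Set} (f : B → ℕ) (g : A → B) (xs : List A) → listSum f (map g xs) ≡ listSum (f ∘ g) xs
listSum-map f g []       = refl
listSum-map f g (x ∷ xs) = cong (f (g x) +_) (listSum-map f g xs)

listSum-concatMap : {A B : Set} (f : B → ℕ) (g : A → List B) (xs : List A) →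
  listSum f (concatMap g xs) ≡ listSum (listSum f ∘ g) xs
listSum-concatMap f g []       = refl
listSum-concatMap f g (x ∷ xs) =
  trans (listSum-++ f (g x) (concatMap g xs)) (cong (listSum f (g x) +_) (listSum-concatMap f g xs))

listSum-*ˡ : {A : Set} (c : ℕ) (f : A → ℕ) (xs : List A) → listSum (λ x → c * f x) xs ≡ c * listSum f xs
listSum-*ˡ c f []       = sym (*-zeroʳ c)
listSum-*ˡ c f (x ∷ xs) = trans (cong (c * f x +_) (listSum-*ˡ c f xs)) (sym (*-distribˡ-+ c (f x) _))

listSum-allFin : ∀ {n} (f : Fin n → ℕ) → listSum f (allFin n) ≡ ∑[ i < n ] f i
listSum-allFin f = listSum-tabulate f id
  where
  listSum-tabulate : ∀ {m k} (f : Fin m → ℕ) (g : Fin k → Fin m) → listSum f (tabulate g) ≡ ∑[ i < k ] f (g i)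
  listSum-tabulate {k = zero}  f g = refl
  listSum-tabulate {k = suc k} f g = cong (f (g zero) +_) (listSum-tabulate f (g ∘ suc))

listSum-cartesianProduct : {A B : Set} (f : A × B → ℕ) (xs : List A) (ys : List B) →
  listSum f (cartesianProduct xs ys) ≡ listSum (λ x → listSum (λ y → f (x , y)) ys) xs
listSum-cartesianProduct f []       ys = refl
listSum-cartesianProduct f (x ∷ xs) ys =
  trans (listSum-++ f (map (x ,_) ys) (cartesianProduct xs ys))
        (cong₂ _+_ (listSum-map f (x ,_) ys) (listSum-cartesianProduct f xs ys))

listSum-allTuples : ∀ {n j} (f : Vec (Fin n) (suc j) → ℕ) →
  listSum f (allTuples n (suc j)) ≡ ∑[ y < n ] listSum (λ ys → f (y ∷ ys)) (allTuples n j)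
listSum-allTuples {n} {j} f = begin
  listSum f (concatMap (λ y → map (y ∷_) (allTuples n j)) (allFin n))
    ≡⟨ listSum-concatMap f _ (allFin n) ⟩
  listSum (λ y → listSum f (map (y ∷_) (allTuples n j))) (allFin n)
    ≡⟨ listSum-allFin {n} _ ⟩
  ∑[ y < n ] listSum f (map (y ∷_) (allTuples n j))
    ≡⟨ sum-cong-≗ (λ y → listSum-map f (y ∷_) (allTuples n j)) ⟩
  ∑[ y < n ] listSum (λ ys → f (y ∷ ys)) (allTuples n j) ∎
  where open ≡-Reasoning

-- The arithmetic of one deletion step (P = p^k, Q = q^k): if deleting a vertex
-- loses at most d edges, c walks and one vertex, and the cost P·q·d of the edges
-- is covered by c·q·Q + p·P, then the bound for the smaller set gives the larger.
deletion-step : ∀ P Q p q E E′ d W W′ N N′ c →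
  E ≤ E′ + d →
  P * q * d ≤ c * (q * Q) + p * P →
  P * q * E′ ≤ W′ * (q * Q) + N′ * (p * P) →
  c + W′ ≤ W → 1 + N′ ≡ N →
  P * q * E ≤ W * (q * Q) + N * (p * P)
deletion-step P Q p q E E′ d W W′ N N′ c E≤ cost ih W≥ N≡ = begin
  P * q * E                                                     ≤⟨ *-monoʳ-≤ (P * q) E≤ ⟩
  P * q * (E′ + d)                                              ≡⟨ *-distribˡ-+ (P * q) E′ d ⟩
  P * q * E′ + P * q * d                                        ≤⟨ +-mono-≤ ih cost ⟩
  W′ * (q * Q) + N′ * (p * P) + (c * (q * Q) + p * P)           ≡⟨ regroup W′ N′ c (q * Q) (p * P) ⟩
  (c + W′) * (q * Q) + (1 + N′) * (p * P)                       ≤⟨ +-mono-≤ (*-monoˡ-≤ (q * Q) W≥) (≤-reflexive (cong (_* (p * P)) N≡)) ⟩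
  W * (q * Q) + N * (p * P)                                     ∎
  where
  open ≤-Reasoning
  regroup : ∀ w n c x y → w * x + n * y + (c * x + y) ≡ (c + w) * x + (1 + n) * y
  regroup = solve-∀

module CappedWalkBound {n : ℕ} (G : Graph n) {_≼_ : Rel (Fin n) 0ℓ} (ord : IsDecTotalOrder _≡_ _≼_) where

  open IsDecTotalOrder ord using (total) renaming (_≤?_ to _≼?_; refl to ≼-refl; trans to ≼-trans)

  adj : Fin n → Fin n → Bool
  adj u v = does (adj? G u v)

  adj-sym : ∀ u v → adj u v ≡ adj v u
  adj-sym u v = does-⇔ (mk⇔ (Graph.sym G) (Graph.sym G)) (adj? G u v) (adj? G v u)

  VertexSet : Set
  VertexSet = Fin n → Bool

  _⊆_ : VertexSet → VertexSet → Set
  S ⊆ T = ∀ u → S u ≡ true → T u ≡ true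

  _─_ : VertexSet → Fin n → VertexSet
  (S ─ v) u = not (does (u Fin.≟ v)) ∧ S u

  ─-⊆ : ∀ S v → (S ─ v) ⊆ S
  ─-⊆ S v u = Bool.∧-conicalʳ _ (S u)

  below : VertexSet → Fin n → VertexSet
  below S v u = S u ∧ does (u ≼? v)

  below-mono : ∀ {S T} → S ⊆ T → ∀ v → below S v ⊆ below T v
  below-mono {S} S⊆T v u h rewrite S⊆T u (Bool.∧-conicalˡ (S u) _ h) = Bool.∧-conicalʳ (S u) _ h

  size : VertexSet → ℕ
  size S = ∑[ u < n ] 𝟙 (S u)

  deg : VertexSet → Fin n → ℕ
  deg S v = ∑[ u < n ] 𝟙 (S u ∧ adj v u)

  edge : Fin n → Fin n → Bool
  edge i j = does (i Fin.<? j) ∧ adj i j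

  edges : VertexSet → ℕ
  edges S = ∑[ i < n ] ∑[ j < n ] 𝟙 ((S i ∧ S j) ∧ edge i j)

  -- Number of walks of length j from x all of whose later vertices lie in T.
  walks : VertexSet → ℕ → Fin n → ℕ
  walks T zero    x = 1
  walks T (suc j) x = ∑[ y < n ] (𝟙 (T y ∧ adj x y) * walks T j y)

  -- Number of capped k-walks inside S: walks from v ∈ S staying in S below v.
  capped : ℕ → VertexSet → ℕ
  capped k S = ∑[ v < n ] (𝟙 (S v) * walks (below S v) k v)

  walks-mono : ∀ {T T′} → T ⊆ T′ → ∀ j x → walks T j x ≤ walks T′ j x
  walks-mono T⊆T′ zero    x = ≤-refl
  walks-mono T⊆T′ (suc j) x =
    ∑-mono-≤ (λ y → *-mono-≤ (𝟙-mono (∧-monoˡ (adj x y) (T⊆T′ y))) (walks-mono T⊆T′ j y))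

  capped-mono : ∀ k {S T} → S ⊆ T → capped k S ≤ capped k T
  capped-mono k S⊆T = ∑-mono-≤ (λ v → *-mono-≤ (𝟙-mono (S⊆T v)) (walks-mono (below-mono S⊆T v) k v))

  walks-extend : ∀ S p q j → (∀ u → S u ≡ true → p ^ j ≤ walks S j u * q ^ j) →
    ∀ t → deg S t * p ^ j ≤ walks S (suc j) t * q ^ j
  walks-extend S p q j bound t = begin
    deg S t * p ^ j                                         ≡⟨ *-distribʳ-sum {n} (p ^ j) _ ⟩
    ∑[ y < n ] (𝟙 (S y ∧ adj t y) * p ^ j)                  ≤⟨ ∑-mono-≤ (λ y → 𝟙-guard _ (bound y ∘ Bool.∧-conicalˡ _ _)) ⟩
    ∑[ y < n ] (𝟙 (S y ∧ adj t y) * (walks S j y * q ^ j))  ≡⟨ sum-cong-≗ (λ y → sym (*-assoc (𝟙 (S y ∧ adj t y)) _ _)) ⟩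
    ∑[ y < n ] (𝟙 (S y ∧ adj t y) * walks S j y * q ^ j)    ≡⟨ *-distribʳ-sum {n} (q ^ j) _ ⟨
    walks S (suc j) t * q ^ j                               ∎
    where open ≤-Reasoning

  walks-lower-bound : ∀ S p q → (∀ u → S u ≡ true → p ≤ q * deg S u) →
    ∀ j u → S u ≡ true → p ^ j ≤ walks S j u * q ^ j
  walks-lower-bound S p q min-deg zero    u Su = ≤-refl
  walks-lower-bound S p q min-deg (suc j) u Su = begin
    p * p ^ j                       ≤⟨ *-monoˡ-≤ (p ^ j) (min-deg u Su) ⟩
    q * deg S u * p ^ j             ≡⟨ *-assoc q (deg S u) (p ^ j) ⟩
    q * (deg S u * p ^ j)           ≤⟨ *-monoʳ-≤ q (walks-extend S p q j (walks-lower-bound S p q min-deg j) u) ⟩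
    q * (walks S (suc j) u * q ^ j) ≡⟨ x∙yz≈y∙xz q (walks S (suc j) u) (q ^ j) ⟩
    walks S (suc j) u * (q * q ^ j) ∎
    where open ≤-Reasoning

  edge-split : ∀ (S : VertexSet) v i j →
    𝟙 ((S i ∧ S j) ∧ edge i j) ≤
      𝟙 (((S ─ v) i ∧ (S ─ v) j) ∧ edge i j) + δ v i * 𝟙 (S j ∧ edge v j) + δ v j * 𝟙 (S i ∧ edge i v)
  edge-split S v i j with i Fin.≟ v | j Fin.≟ v
  ... | no _ | no _ = ≤-trans (m≤m+n _ 0) (m≤m+n _ 0)
  ... | yes refl | _ =
    ≤-trans (𝟙-mono (forget-first (S i) (S j) (edge i j))) (≤-trans (m≤m+n _ 0) (m≤m+n _ _))
    where
    forget-first : ∀ a b c → (a ∧ b) ∧ c ≡ true → b ∧ c ≡ true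
    forget-first true b c h = h
  ... | no _ | yes refl =
    ≤-trans (𝟙-mono (forget-second (S i) (S j) (edge i j)))
            (≤-trans (m≤m+n _ 0) (m≤n+m _ (𝟙 ((S i ∧ false) ∧ edge i v) + 0)))
    where
    forget-second : ∀ a b c → (a ∧ b) ∧ c ≡ true → a ∧ c ≡ true
    forget-second true true c h = h

  -- Every edge at v is listed with v first or with v second, never both.
  edges-at-≤-deg : ∀ (S : VertexSet) v u → 𝟙 (S u ∧ edge v u) + 𝟙 (S u ∧ edge u v) ≤ 𝟙 (S u ∧ adj v u)
  edges-at-≤-deg S v u =
    subst (λ b → 𝟙 (S u ∧ edge v u) + 𝟙 (S u ∧ (does (u Fin.<? v) ∧ b)) ≤ 𝟙 (S u ∧ adj v u))
          (adj-sym v u)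
          (𝟙-exclusive (S u) (adj v u) (v Fin.<? u) (u Fin.<? v) Fin.<-asym)

  edges-remove : ∀ (S : VertexSet) v → edges S ≤ edges (S ─ v) + deg S v
  edges-remove S v = begin
    edges S                                                          ≤⟨ ∑-mono-≤ (λ i → ∑-mono-≤ (edge-split S v i)) ⟩
    ∑[ i < n ] ∑[ j < n ] (kept i j + first i j + second i j)        ≡⟨ sum-cong-≗ (λ i → ∑-distrib-+₃ (kept i) (first i) (second i)) ⟩
    ∑[ i < n ] (sum (kept i) + sum (first i) + sum (second i))       ≡⟨ ∑-distrib-+₃ (sum ∘ kept) (sum ∘ first) (sum ∘ second) ⟩
    edges (S ─ v) + ∑[ i < n ] sum (first i) + ∑[ i < n ] sum (second i)
                                                                     ≡⟨ cong₂ (λ x y → edges (S ─ v) + x + y) first-total second-total ⟩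
    edges (S ─ v) + sum out + sum into                               ≡⟨ +-assoc (edges (S ─ v)) (sum out) (sum into) ⟩
    edges (S ─ v) + (sum out + sum into)                             ≡⟨ cong (edges (S ─ v) +_) (∑-distrib-+ out into) ⟨
    edges (S ─ v) + ∑[ u < n ] (out u + into u)                      ≤⟨ +-monoʳ-≤ (edges (S ─ v)) (∑-mono-≤ (edges-at-≤-deg S v)) ⟩
    edges (S ─ v) + deg S v                                          ∎
    where
    open ≤-Reasoning
    out into : Fin n → ℕ
    out   u = 𝟙 (S u ∧ edge v u)
    into  u = 𝟙 (S u ∧ edge u v)
    kept first second : Fin n → Fin n → ℕ
    kept   i j = 𝟙 (((S ─ v) i ∧ (S ─ v) j) ∧ edge i j)
    first  i j = δ v i * out j
    second i j = δ v j * into i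
    first-total : ∑[ i < n ] sum (first i) ≡ sum out
    first-total = trans (sum-cong-≗ (λ i → sym (*-distribˡ-sum (δ v i) out))) (∑-δ v (sum out))
    second-total : ∑[ i < n ] sum (second i) ≡ sum into
    second-total = sum-cong-≗ (λ i → ∑-δ v (into i))

  size-remove : ∀ (S : VertexSet) v → S v ≡ true → 1 + size (S ─ v) ≡ size S
  size-remove S v Sv = begin
    1 + size (S ─ v)                                     ≡⟨ cong (_+ size (S ─ v)) (∑-δ v 1) ⟨
    ∑[ u < n ] (δ v u * 1) + size (S ─ v)                ≡⟨ ∑-distrib-+ (λ u → δ v u * 1) (𝟙 ∘ (S ─ v)) ⟨
    ∑[ u < n ] (δ v u * 1 + 𝟙 ((S ─ v) u))               ≡⟨ sum-cong-≗ split ⟩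
    size S                                               ∎
    where
    open ≡-Reasoning
    split : ∀ u → δ v u * 1 + 𝟙 ((S ─ v) u) ≡ 𝟙 (S u)
    split u with u Fin.≟ v
    ... | yes refl rewrite Sv = refl
    ... | no _     = refl

  size-remove-< : ∀ (S : VertexSet) v → S v ≡ true → size (S ─ v) < size S
  size-remove-< S v Sv = ≤-reflexive (size-remove S v Sv)

  IsTop : VertexSet → Fin n → Set
  IsTop S t = S t ≡ true × (∀ u → S u ≡ true → u ≼ t)

  ⊆-below-top : ∀ (S : VertexSet) t → IsTop S t → S ⊆ below S t
  ⊆-below-top S t (_ , top) u Su rewrite Su = dec-true (u ≼? t) (top u Su)

  -- Deleting the top vertex t loses (at least) the capped walks starting at t,
  -- and since t is greatest, these are all walks from t inside S.
  capped-remove-top : ∀ k (S : VertexSet) t → IsTop S t → walks S k t + capped k (S ─ t) ≤ capped k S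
  capped-remove-top k S t t-top@(St , _) = begin
    walks S k t + capped k (S ─ t)                              ≡⟨ cong (_+ capped k (S ─ t)) (∑-δ t (walks S k t)) ⟨
    ∑[ w < n ] (δ t w * walks S k t) + capped k (S ─ t)         ≡⟨ ∑-distrib-+ (λ w → δ t w * walks S k t) (λ w → 𝟙 ((S ─ t) w) * walks (below (S ─ t) w) k w) ⟨
    ∑[ w < n ] (δ t w * walks S k t + 𝟙 ((S ─ t) w) * walks (below (S ─ t) w) k w)
                                                                ≤⟨ ∑-mono-≤ pointwise ⟩
    capped k S                                                  ∎
    where
    open ≤-Reasoning
    pointwise : ∀ w → δ t w * walks S k t + 𝟙 ((S ─ t) w) * walks (below (S ─ t) w) k w
                      ≤ 𝟙 (S w) * walks (below S w) k w
    pointwise w with w Fin.≟ t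
    ... | yes refl rewrite St =
      ≤-trans (≤-reflexive (+-identityʳ _)) (+-monoˡ-≤ 0 (walks-mono (⊆-below-top S w t-top) k w))
    ... | no _ = *-monoʳ-≤ (𝟙 (S w)) (walks-mono (below-mono (─-⊆ S t) w) k w)

  top-among : ∀ (S : VertexSet) (xs : List (Fin n)) →
    (∃ λ t → S t ≡ true × (∀ u → u ∈ xs → S u ≡ true → u ≼ t)) ⊎ (∀ u → u ∈ xs → S u ≡ false)
  top-among S [] = inj₂ λ _ ()
  top-among S (x ∷ xs) with top-among S xs | S x in Sx
  ... | inj₂ none | false = inj₂ λ { u (here refl) → Sx ; u (there u∈xs) → none u u∈xs }
  ... | inj₂ none | true  =
    inj₁ (x , Sx , λ { u (here refl) _ → ≼-refl ; u (there u∈xs) Su → ⊥-elim (true≢false Su (none u u∈xs)) })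
  ... | inj₁ (t , St , top) | false =
    inj₁ (t , St , λ { u (here refl) Su → ⊥-elim (true≢false Su Sx) ; u (there u∈xs) Su → top u u∈xs Su })
  ... | inj₁ (t , St , top) | true with total x t
  ...   | inj₁ x≼t = inj₁ (t , St , λ { u (here refl) _ → x≼t ; u (there u∈xs) Su → top u u∈xs Su })
  ...   | inj₂ t≼x = inj₁ (x , Sx , λ { u (here refl) _ → ≼-refl ; u (there u∈xs) Su → ≼-trans (top u u∈xs Su) t≼x })

  top-or-empty : ∀ (S : VertexSet) → (∃ λ t → IsTop S t) ⊎ (∀ u → S u ≡ false)
  top-or-empty S with top-among S (allFin n)
  ... | inj₁ (t , St , top) = inj₁ (t , St , λ u → top u (∈-allFin u))
  ... | inj₂ none           = inj₂ λ u → none u (∈-allFin u)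

  edges-empty : ∀ (S : VertexSet) → (∀ u → S u ≡ false) → edges S ≡ 0
  edges-empty S empty = ∑-zero λ i → ∑-zero λ j → cong (λ b → 𝟙 ((b ∧ S j) ∧ edge i j)) (empty i)

  DegeneracyBound : ℕ → ℕ → ℕ → VertexSet → Set
  DegeneracyBound p q k S =
    p ^ k * q * edges S ≤ capped (suc k) S * (q * q ^ k) + size S * (p * p ^ k)

  delete-vertex : ∀ p q k (S : VertexSet) v c → S v ≡ true →
    p ^ k * q * deg S v ≤ c * (q * q ^ k) + p * p ^ k →
    c + capped (suc k) (S ─ v) ≤ capped (suc k) S →
    DegeneracyBound p q k (S ─ v) → DegeneracyBound p q k S
  delete-vertex p q k S v c Sv cost lost ih =
    deletion-step (p ^ k) (q ^ k) p q _ _ (deg S v) _ _ _ _ c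
                  (edges-remove S v) cost ih lost (size-remove S v Sv)

  low-degree-cost : ∀ p q k (S : VertexSet) v → q * deg S v < p →
    p ^ k * q * deg S v ≤ 0 * (q * q ^ k) + p * p ^ k
  low-degree-cost p q k S v low = begin
    p ^ k * q * deg S v   ≡⟨ *-assoc (p ^ k) q (deg S v) ⟩
    p ^ k * (q * deg S v) ≤⟨ *-monoʳ-≤ (p ^ k) (<⇒≤ low) ⟩
    p ^ k * p             ≡⟨ *-comm (p ^ k) p ⟩
    p * p ^ k             ∎
    where open ≤-Reasoning

  min-degree-cost : ∀ p q k (S : VertexSet) t → (∀ u → S u ≡ true → p ≤ q * deg S u) →
    p ^ k * q * deg S t ≤ walks S (suc k) t * (q * q ^ k) + p * p ^ k
  min-degree-cost p q k S t min-deg = begin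
    p ^ k * q * deg S t             ≡⟨ xy∙z≈y∙zx (p ^ k) q (deg S t) ⟩
    q * (deg S t * p ^ k)           ≤⟨ *-monoʳ-≤ q (walks-extend S p q k (walks-lower-bound S p q min-deg k) t) ⟩
    q * (walks S (suc k) t * q ^ k) ≡⟨ x∙yz≈y∙xz q (walks S (suc k) t) (q ^ k) ⟩
    walks S (suc k) t * (q * q ^ k) ≤⟨ m≤m+n _ (p * p ^ k) ⟩
    walks S (suc k) t * (q * q ^ k) + p * p ^ k ∎
    where open ≤-Reasoning

  -- Every vertex set satisfies the invariant (induction on a bound f for its size):
  -- delete a low-degree vertex if there is one, and the top vertex otherwise.
  degeneracy : ∀ p q k f S → size S ≤ f → DegeneracyBound p q k S
  degeneracy p q k f S size≤f with top-or-empty S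
  ... | inj₂ empty rewrite edges-empty S empty | *-zeroʳ (p ^ k * q) = z≤n
  ... | inj₁ (t , t-top@(St , _)) with f
  ...   | zero = ⊥-elim (n≮0 (<-≤-trans (size-remove-< S t St) size≤f))
  ...   | suc f with Fin.any? (λ v → (S v Bool.≟ true) ×-dec (q * deg S v <? p))
  ...     | yes (v , Sv , low) =
    delete-vertex p q k S v 0 Sv (low-degree-cost p q k S v low) (capped-mono (suc k) (─-⊆ S v))
                  (degeneracy p q k f (S ─ v) (s≤s⁻¹ (<-≤-trans (size-remove-< S v Sv) size≤f)))
  ...     | no no-low =
    delete-vertex p q k S t (walks S (suc k) t) St (min-degree-cost p q k S t min-deg)
                  (capped-remove-top (suc k) S t t-top)
                  (degeneracy p q k f (S ─ t) (s≤s⁻¹ (<-≤-trans (size-remove-< S t St) size≤f)))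
    where
    min-deg : ∀ u → S u ≡ true → p ≤ q * deg S u
    min-deg u Su = ≮⇒≥ (λ low → no-low (u , Su , low))

  full : VertexSet
  full _ = true

  size-full : size full ≡ n
  size-full = ∑-one n

  edges-full : edges full ≡ numEdges G
  edges-full = sym (begin
    numEdges G                                                  ≡⟨ length-filter _ (cartesianProduct (allFin n) (allFin n)) ⟩
    listSum listed (cartesianProduct (allFin n) (allFin n))     ≡⟨ listSum-cartesianProduct listed (allFin n) (allFin n) ⟩
    listSum (λ i → listSum (λ j → listed (i , j)) (allFin n)) (allFin n)
                                                                ≡⟨ listSum-allFin {n} _ ⟩
    ∑[ i < n ] listSum (λ j → listed (i , j)) (allFin n)        ≡⟨ sum-cong-≗ (λ i → listSum-allFin {n} (λ j → listed (i , j))) ⟩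
    edges full                                                  ∎)
    where
    open ≡-Reasoning
    listed : Fin n × Fin n → ℕ
    listed (i , j) = 𝟙 (edge i j)

  walks-as-tuples : ∀ {P : Fin n → Set} (T? : ∀ u → Dec (P u)) j x →
    listSum (λ xs → 𝟙 (does (isWalk? G (x ∷ xs)) ∧ does (all? T? xs))) (allTuples n j)
      ≡ walks (does ∘ T?) j x
  walks-as-tuples T? zero    x = refl
  walks-as-tuples T? (suc j) x = begin
    listSum walk-from-x (allTuples n (suc j))                          ≡⟨ listSum-allTuples walk-from-x ⟩
    ∑[ y < n ] listSum (λ ys → walk-from-x (y ∷ ys)) (allTuples n j)  ≡⟨ sum-cong-≗ first-step ⟩
    walks (does ∘ T?) (suc j) x                                        ∎
    where
    open ≡-Reasoning
    walk-from : Fin n → Vec (Fin n) j → ℕ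
    walk-from y ys = 𝟙 (does (isWalk? G (y ∷ ys)) ∧ does (all? T? ys))
    walk-from-x : Vec (Fin n) (suc j) → ℕ
    walk-from-x xs = 𝟙 (does (isWalk? G (x ∷ xs)) ∧ does (all? T? xs))
    -- A tuple y ∷ ys counts iff x–y is an allowed step and ys counts from y.
    interchange : ∀ a b c d → 𝟙 ((a ∧ b) ∧ (c ∧ d)) ≡ 𝟙 (c ∧ a) * 𝟙 (b ∧ d)
    interchange a b c d = trans (cong 𝟙 (regroup a c)) (𝟙-∧ (c ∧ a) (b ∧ d))
      where
      regroup : ∀ a c → (a ∧ b) ∧ (c ∧ d) ≡ (c ∧ a) ∧ (b ∧ d)
      regroup true  true  = refl
      regroup true  false = Bool.∧-zeroʳ b
      regroup false true  = refl
      regroup false false = refl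
    first-step : ∀ y → listSum (λ ys → walk-from-x (y ∷ ys)) (allTuples n j)
                       ≡ 𝟙 (does (T? y) ∧ adj x y) * walks (does ∘ T?) j y
    first-step y = begin
      listSum (λ ys → walk-from-x (y ∷ ys)) (allTuples n j)
        ≡⟨ listSum-cong (λ ys → interchange (adj x y) _ (does (T? y)) _) (allTuples n j) ⟩
      listSum (λ ys → 𝟙 (does (T? y) ∧ adj x y) * walk-from y ys) (allTuples n j)
        ≡⟨ listSum-*ˡ (𝟙 (does (T? y) ∧ adj x y)) (walk-from y) (allTuples n j) ⟩
      𝟙 (does (T? y) ∧ adj x y) * listSum (walk-from y) (allTuples n j)
        ≡⟨ cong (𝟙 (does (T? y) ∧ adj x y) *_) (walks-as-tuples T? j y) ⟩
      𝟙 (does (T? y) ∧ adj x y) * walks (does ∘ T?) j y ∎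

  capped-full : ∀ k → capped k full ≡ numCappedWalks G ord k
  capped-full k = sym (begin
    numCappedWalks G ord k                                     ≡⟨ length-filter _ (allTuples n (suc k)) ⟩
    listSum capped-walk (allTuples n (suc k))                  ≡⟨ listSum-allTuples capped-walk ⟩
    ∑[ x < n ] listSum (λ xs → capped-walk (x ∷ xs)) (allTuples n k)
                                                               ≡⟨ sum-cong-≗ (λ x → walks-as-tuples (_≼? x) k x) ⟩
    ∑[ x < n ] walks (below full x) k x                        ≡⟨ sum-cong-≗ (λ x → sym (+-identityʳ (walks (below full x) k x))) ⟩
    capped k full                                              ∎)
    where
    open ≡-Reasoning
    capped-walk : Vec (Fin n) (suc k) → ℕ
    capped-walk xs = 𝟙 (does (isWalk? G xs ×-dec isCapped? _≼?_ xs))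

-- Apply the
-- degeneracy bound with p = m, q = 2n to the whole vertex set; its left side is
-- 2n · m^k, and the term n · m^k on the right cancels against half of it.
lemma2 : (n : ℕ) → 1 ≤ n → (G : Graph n) → (k : ℕ) → 1 ≤ k →
         (_≼_ : Rel (Fin n) 0ℓ) → (ord : IsDecTotalOrder _≡_ _≼_) →
         n * numEdges G ^ k ≤ numCappedWalks G ord k * (2 * n) ^ k
lemma2 n _ G zero    () _≼_ ord
lemma2 n _ G (suc k) _  _≼_ ord = +-cancelʳ-≤ (n * m ^ suc k) _ _ (begin
  n * m ^ suc k + n * m ^ suc k                                   ≡⟨ doubling n m (m ^ k) ⟩
  m ^ k * (2 * n) * m                                             ≡⟨ cong (m ^ k * (2 * n) *_) edges-full ⟨
  m ^ k * (2 * n) * edges full                                    ≤⟨ degeneracy m (2 * n) k (size full) full ≤-refl ⟩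
  capped (suc k) full * (2 * n) ^ suc k + size full * m ^ suc k   ≡⟨ cong₂ (λ w s → w * (2 * n) ^ suc k + s * m ^ suc k) (capped-full (suc k)) size-full ⟩
  numCappedWalks G ord (suc k) * (2 * n) ^ suc k + n * m ^ suc k  ∎)
  where
  open CappedWalkBound G ord
  open ≤-Reasoning
  m : ℕ
  m = numEdges G
  doubling : ∀ n m x → n * (m * x) + n * (m * x) ≡ x * (2 * n) * m
  doubling = solve-∀
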